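{- Let $G$ be a finite group and $H$ a connected directed graph with a rotation system, cellularly embedded in the oriented closed surface $S$ determined by this rotation system, and let $H^*$ be its dual in $S$. If $\psi$ is a nowhere-identity $G$-flow on $H$, then the graph $H^*_{\psi^*}$ (defined below, for any choice of base vertex) admits a proper $G$-coloring, where $\psi^*$ is the map on edges of $H^*$ given by $\psi^*(e^*) = \psi(e)$.
   Context: Graphs may have multiple edges and loops. Rotation system: a cyclic order of edge-ends at each vertex (a loop contributes two). Listing the edge-ends at $v$ cyclically as $e_v^1,\dots,e_v^{d(v)}$ with $\sigma_v=+1$ for edge-ends where the edge enters $v$ and $-1$ where it leaves, a $G$-flow is $\psi: E \to G$ with $\prod_i \psi(e_v^i)^{\sigma_v(e_v^i)} = 1$ at every vertex; nowhere-identity means $\psi(e)\neq 1$ for all $e$. The dual $H^*$ has a vertex for each face of $H$ and, for each edge $e$ of $H$, a dual edge $e^*$ joining the faces on the two sides of $e$, directed so that it crosses $e$ from the left side of $e$ to its right side (w.r.t. the orientation of $S$ and the direction of $e$); $H^*$ carries the rotation system induced by the orientation of $S$. For a walk $W=(e_1,\dots,e_n)$ and a map $\phi$ on edges, $h_\phi(W)=\prod_i \phi(e_i)^{\pm 1}$ with exponent $+1$ iff $e_i$ is traversed in its direction. For a directed graph $K$ with rotation system, a map $\phi: E(K)\to G$ and a base vertex $x$, the graph $K_\phi$ has as vertices the pairs $(e(W), h_\phi(W))$ for walks $W$ in $K$ starting at $x$ ($e(W)$ the end vertex), and for each such vertex $(a,h)$ and each edge $f$ of $K$ directed from $a$ to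 $b$ an edge from $(a,h)$ to $(b, h\phi(f))$. A proper $G$-coloring is a map from vertices to $G$ giving distinct colors to the two endpoints of every edge. -}

module Defs where

open import Level using (Level; _⊔_)
open import Data.Nat using (ℕ; zero; suc; _<_; _*_; _+_; _<ᵇ_)
open import Data.Fin using (Fin; toℕ)
open import Data.Bool using (Bool; true; false; not; if_then_else_)
open import Data.Product using (Σ; ∃; _×_; _,_; proj₁; proj₂)
open import Data.List using (List; []; _∷_; map; foldr; upTo)
open import Relation.Binary.PropositionalEquality using (_≡_; _≢_)
open import Relation.Nullary using (¬_)
open import Algebra.Bundles using (Group)

iter : ∀ {a} {A : Set a} → (A → A) → ℕ → A → A
iter f zero    x = x
iter f (suc k) x = f (iter f k x)

record DiGraph : Set₁ where
  field
    Vtx  : Set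
    Edge : Set
    tail : Edge → Vtx
    head : Edge → Vtx

module _ (K : DiGraph) where
  open DiGraph K

  data Walk : Vtx → Vtx → Set where
    []  : ∀ {a} → Walk a a
    fwd : ∀ {a b} (e : Edge) → tail e ≡ a → Walk (head e) b → Walk a b
    bwd : ∀ {a b} (e : Edge) → head e ≡ a → Walk (tail e) b → Walk a b

  hval : ∀ {c ℓ} (G : Group c ℓ) → (Edge → Group.Carrier G) →
         ∀ {a b} → Walk a b → Group.Carrier G
  hval G φ []           = Group.ε G
  hval G φ (fwd e _ W)  = Group._∙_ G (φ e) (hval G φ W)
  hval G φ (bwd e _ W)  = Group._∙_ G (Group._⁻¹ G (φ e)) (hval G φ W)

  Connected : Set
  Connected = ∀ u v → Walk u v

  -- (a , h) is a vertex of K_φ (base vertex x): there is a walk W from x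
  -- with end vertex a and h_φ(W) = h.
  IsVertexOfKφ : ∀ {c ℓ} (G : Group c ℓ) → (Edge → Group.Carrier G) →
                 Vtx → Vtx → Group.Carrier G → Set ℓ
  IsVertexOfKφ G φ x a h =
    Σ (Walk x a) λ W → Group._≈_ G (hval G φ W) h

  -- A proper G-colouring of K_φ: a colouring of the pairs (a , h)
  -- (respecting equality in G) such that for every vertex (a , h) of K_φ
  -- and every edge f of K from a to b, the endpoints (a , h) and
  -- (b , h φ(f)) of the corresponding edge of K_φ get distinct colours.
  ProperColouringKφ : ∀ {c ℓ} (G : Group c ℓ) → (Edge → Group.Carrier G) →
                      Vtx → Set (c ⊔ ℓ)
  ProperColouringKφ G φ x =
    Σ (Vtx → Carrier → Carrier) λ col →
      (∀ a h h′ → h ≈ h′ → col a h ≈ col a h′) ×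
      (∀ a h → IsVertexOfKφ G φ x a h →
        ∀ f → tail f ≡ a → ¬ (col a h ≈ col (head f) (h ∙ φ f)))
    where open Group G

record FinDiGraph : Set where
  field
    nV nE : ℕ
    tail head : Fin nE → Fin nV

module _ (H : FinDiGraph) where
  open FinDiGraph H

  asDiGraph : DiGraph
  asDiGraph = record { Vtx = Fin nV ; Edge = Fin nE ; tail = tail ; head = head }

  -- Edge-ends (darts): (e , true) is the end where e enters its head,
  -- (e , false) the end where e leaves its tail.  A loop gives two darts
  -- at the same vertex.
  Dart : Set
  Dart = Fin nE × Bool

  dartVertex : Dart → Fin nV
  dartVertex (e , true)  = head e
  dartVertex (e , false) = tail e

  flipDart : Dart → Dart
  flipDart (e , b) = (e , not b)

  -- A rotation system: a permutation ρ of the darts whose cycles are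
  -- exactly the sets of darts at each vertex; ρ d is the successor of d
  -- in the cyclic order at its vertex (positive sense of the orientation
  -- of the surface S determined by the rotation system).
  record RotationSystem : Set where
    field
      ρ ρ⁻ : Dart → Dart
      ρ⁻-ρ : ∀ d → ρ⁻ (ρ d) ≡ d
      ρ-ρ⁻ : ∀ d → ρ (ρ⁻ d) ≡ d
      ρ-vertex : ∀ d → dartVertex (ρ d) ≡ dartVertex d
      ρ-cyclic : ∀ d d′ → dartVertex d ≡ dartVertex d′ → ∃ λ k → iter ρ k d ≡ d′

  module _ (R : RotationSystem) where
    open RotationSystem R

    IsCycleLength : Dart → ℕ → Set
    IsCycleLength d p =
      (0 < p) × (iter ρ p d ≡ d) × (∀ j → 0 < j → j < p → iter ρ j d ≢ d)

    module _ {c ℓ} (G : Group c ℓ) where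
      open Group G

      dartValue : (Fin nE → Carrier) → Dart → Carrier
      dartValue ψ (e , true)  = ψ e
      dartValue ψ (e , false) = ψ e ⁻¹

      prodAround : (Fin nE → Carrier) → Dart → ℕ → Carrier
      prodAround ψ d zero    = ε
      prodAround ψ d (suc p) = dartValue ψ d ∙ prodAround ψ (ρ d) p

      -- G-flow: at every vertex the ordered product around the rotation
      -- is the identity (checked from every starting dart; vertices with
      -- no edge-ends impose nothing, the empty product being 1).
      IsGFlow : (Fin nE → Carrier) → Set ℓ
      IsGFlow ψ = ∀ d p → IsCycleLength d p → prodAround ψ d p ≈ ε

      NowhereIdentity : (Fin nE → Carrier) → Set ℓ
      NowhereIdentity ψ = ∀ e → ¬ (ψ e ≈ ε)

    -- Faces: the orbits of the face permutation φ = ρ ∘ flip.  The orbit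
    -- of dart d is the face lying to the right of d when its edge is
    -- traversed starting from dartVertex d.
    facePerm : Dart → Dart
    facePerm d = ρ (flipDart d)

    dartKey : Dart → ℕ
    dartKey (e , b) = toℕ e * 2 + (if b then 1 else 0)

    private
      smaller : Dart → Dart → Dart
      smaller x acc = if dartKey x <ᵇ dartKey acc then x else acc

    -- Canonical representative of the face containing d: the dart of
    -- least key in its orbit {φ^k d | k < 2·nE} (the orbit has at most
    -- 2·nE elements).  Faces are identified with these representatives.
    faceOf : Dart → Dart
    faceOf d = foldr smaller d (map (λ k → iter facePerm k d) (upTo (nE * 2)))

    -- The dual H*: one vertex per face, and for each edge e a dual edge
    -- e* (same index) from the face on the left of e to the face on the
    -- right of e.
    dual : DiGraph
    dual = record
      { Vtx  = Dart
      ; Edge = Fin nE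
      ; tail = λ e → faceOf (e , true)
      ; head = λ e → faceOf (e , false)
      }

IsFiniteGroup : ∀ {c ℓ} → Group c ℓ → Set (c ⊔ ℓ)
IsFiniteGroup G =
  Σ ℕ λ n → Σ (Fin n → Carrier) λ enum → ∀ g → Σ (Fin n) λ i → enum i ≈ g
  where open Group G

-- ψ* (e*) = ψ (e): dual edges carry the index of their primal edge.
dualMap : ∀ {c ℓ} {G : Group c ℓ} {m : ℕ} → (Fin m → Group.Carrier G) → (Fin m → Group.Carrier G)
dualMap ψ = λ e → ψ e

-- Colour the vertex (a , h) of K_φ by its group coordinate h.  An edge leaves
-- (a , h) towards (b , h φ(f)), and h φ(f) ≠ h because φ(f) ≠ 1.
module Submission where

open import Defs
open import Algebra.Bundles using (Group)
open import Algebra.Properties.Group using (identityʳ-unique)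
open import Data.Fin using (Fin)
open import Data.Product using (_,_)
open import Relation.Nullary using (¬_)

groupCoordinate-properColouring :
  ∀ {c ℓ} (K : DiGraph) (G : Group c ℓ) (φ : DiGraph.Edge K → Group.Carrier G) →
  (∀ f → ¬ Group._≈_ G (φ f) (Group.ε G)) →
  ∀ x → ProperColouringKφ K G φ x
groupCoordinate-properColouring K G φ φ≉ε x =
  (λ _ h → h) , (λ _ _ _ h≈h′ → h≈h′) ,
  (λ _ h _ f _ h≈hφf → φ≉ε f (identityʳ-unique G h (φ f) (sym h≈hφf)))
  where open Group G using (sym)

theorem4p6 : ∀ {c ℓ} (G : Group c ℓ) → IsFiniteGroup G →
    (H : FinDiGraph) (R : RotationSystem H) →
    Connected (asDiGraph H) →
    (ψ : Fin (FinDiGraph.nE H) → Group.Carrier G) →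
    IsGFlow H R G ψ → NowhereIdentity H R G ψ →
    (x : Dart H) →
    ProperColouringKφ (dual H R) G (dualMap {G = G} ψ) (faceOf H R x)
theorem4p6 G _ H R _ ψ _ ψ≉ε x =
  groupCoordinate-properColouring (dual H R) G (dualMap {G = G} ψ) ψ≉ε (faceOf H R x)
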